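{- Each weakly connected component of a homomorphism homogeneous disconnected oriented graph $\Gamma$, considered as an induced subgraph, is homomorphism homogeneous.
   Context: An oriented graph is a pair $\Gamma=(V,E)$ with $V$ a non-empty set and $E\subseteq V^2$ an asymmetric relation; write $x\sim y$ if $(x,y)\in E$ or $(y,x)\in E$. The weakly connected components are the classes of the equivalence relation "joined by a finite sequence $x=z_0\sim\dots\sim z_k=y$"; $\Gamma$ is disconnected if it has more than one. A homomorphism is an arc-preserving map; an oriented graph is homomorphism homogeneous if every homomorphism between finite induced subgraphs extends to an endomorphism. -}

module Defs where

open import Data.Product using (Σ; Σ-syntax; ∃; ∃-syntax; _×_; _,_; proj₁; proj₂)
open import Data.Sum using (_⊎_)
open import Data.Unit using (⊤; tt)
open import Data.List using (List)
open import Data.List.Relation.Unary.All using (All)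
open import Data.List.Membership.Propositional using (_∈_)
open import Relation.Nullary using (¬_)
open import Relation.Binary.PropositionalEquality using (_≡_)
open import Relation.Binary.Construct.Closure.ReflexiveTransitive using (Star)

record OrientedGraph : Set₁ where
  field
    V        : Set
    E        : V → V → Set
    asym     : ∀ {x y} → E x y → ¬ E y x
    nonempty : V

module _ (Γ : OrientedGraph) where
  open OrientedGraph Γ

  _∼_ : V → V → Set
  x ∼ y = E x y ⊎ E y x

  Joined : V → V → Set
  Joined = Star _∼_

  Component : V → V → Set
  Component v x = Joined v x

  Disconnected : Set
  Disconnected = Σ[ x ∈ V ] Σ[ y ∈ V ] ¬ Joined x y

  -- Homomorphism homogeneity of the induced subgraph of Γ on a vertex
  -- subset P.  A finite induced subgraph of it is given by a list A of
  -- vertices all lying in P.  A homomorphism from the subgraph induced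
  -- on A to the one induced on B is a (well-defined) map on the members
  -- of A, landing in B, preserving arcs.  It must extend to an
  -- endomorphism of the subgraph induced on P.
  HomHomogeneousOn : (V → Set) → Set
  HomHomogeneousOn P =
    (A B : List V) → All P A → All P B →
    (f : Σ V (_∈ A) → V) →
    (∀ a a′ → proj₁ a ≡ proj₁ a′ → f a ≡ f a′) →
    (∀ a → f a ∈ B) →
    (∀ a a′ → E (proj₁ a) (proj₁ a′) → E (f a) (f a′)) →
    Σ[ g ∈ (Σ V P → V) ]
      (∀ u u′ → proj₁ u ≡ proj₁ u′ → g u ≡ g u′) ×
      (∀ u → P (g u)) ×
      (∀ u u′ → E (proj₁ u) (proj₁ u′) → E (g u) (g u′)) ×
      (∀ x (p : x ∈ A) (q : P x) → g (x , q) ≡ f (x , p))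

  HomHomogeneous : Set
  HomHomogeneous = HomHomogeneousOn (λ _ → ⊤)

{-# OPTIONS --safe #-}
-- An endomorphism h of Γ maps every weakly connected component into a single
-- component.  Given a nonempty finite A inside the component C of v, with
-- image B inside C, extend the map to an endomorphism h of Γ: then h sends
-- a ∈ A into C, hence all of C into C, so h restricts to an endomorphism of C.
-- An empty A is extended by the identity.

module Submission where

open import Defs
open import Data.Product using (Σ; _,_; proj₁; proj₂)
open import Data.Sum using (inj₁; inj₂)
open import Data.Unit using (tt)
open import Data.List using ([]; _∷_)
open import Data.List.Relation.Unary.All using (_∷_; lookup; universal)
open import Data.List.Relation.Unary.Any using (here)
open import Data.List.Membership.Propositional using (_∈_)
open import Relation.Binary.PropositionalEquality using (_≡_; refl; sym; subst)
open import Relation.Binary.Construct.Closure.ReflexiveTransitive using (_◅◅_; gmap; reverse)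

open OrientedGraph

IsHomomorphism : (Γ Δ : OrientedGraph) → (V Γ → V Δ) → Set
IsHomomorphism Γ Δ h = ∀ {x y} → E Γ x y → E Δ (h x) (h y)

module _ (Γ : OrientedGraph) where

  ∼-sym : ∀ {x y} → _∼_ Γ x y → _∼_ Γ y x
  ∼-sym (inj₁ e) = inj₂ e
  ∼-sym (inj₂ e) = inj₁ e

  Joined-sym : ∀ {x y} → Joined Γ x y → Joined Γ y x
  Joined-sym = reverse ∼-sym

  module _ (Δ : OrientedGraph) (h : V Γ → V Δ) (hom : IsHomomorphism Γ Δ h) where

    ∼-map : ∀ {x y} → _∼_ Γ x y → _∼_ Δ (h x) (h y)
    ∼-map (inj₁ e) = inj₁ (hom e)
    ∼-map (inj₂ e) = inj₂ (hom e)

    Joined-map : ∀ {x y} → Joined Γ x y → Joined Δ (h x) (h y)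
    Joined-map = gmap h ∼-map

  endomorphism-maps-component : (h : V Γ → V Γ) → IsHomomorphism Γ Γ h → ∀ {v a x} →
    Component Γ v a → Component Γ v (h a) →
    Component Γ v x → Component Γ v (h x)
  endomorphism-maps-component h hom va vha vx =
    vha ◅◅ Joined-map Γ h hom (Joined-sym va ◅◅ vx)

homHomogeneous⇒component-homHomogeneous : (Γ : OrientedGraph) →
  HomHomogeneous Γ → (v : V Γ) → HomHomogeneousOn Γ (Component Γ v)
homHomogeneous⇒component-homHomogeneous Γ _ _ [] _ _ _ _ _ _ _ =
  proj₁ , (λ { _ _ refl → refl }) , proj₂ , (λ _ _ e → e) , (λ _ ())
homHomogeneous⇒component-homHomogeneous Γ hh v (a ∷ A) B (va ∷ _) vB f f-wd f∈B f-hom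
  with hh (a ∷ A) B (universal (λ _ → tt) (a ∷ A)) (universal (λ _ → tt) B) f f-wd f∈B f-hom
... | h̃ , h̃-wd , _ , h̃-hom , h̃-ext = g , g-wd , g-maps , g-hom , g-ext
  where
  h : V Γ → V Γ
  h x = h̃ (x , tt)

  hom : IsHomomorphism Γ Γ h
  hom = h̃-hom (_ , tt) (_ , tt)

  vha : Component Γ v (h a)
  vha = subst (Component Γ v) (sym (h̃-ext a (here refl) tt)) (lookup vB (f∈B (a , here refl)))

  g : Σ (V Γ) (Component Γ v) → V Γ
  g (x , _) = h x

  g-wd : ∀ u u′ → proj₁ u ≡ proj₁ u′ → g u ≡ g u′
  g-wd (x , _) (x′ , _) = h̃-wd (x , tt) (x′ , tt)

  g-maps : ∀ u → Component Γ v (g u)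
  g-maps (_ , vx) = endomorphism-maps-component Γ h hom va vha vx

  g-hom : ∀ u u′ → E Γ (proj₁ u) (proj₁ u′) → E Γ (g u) (g u′)
  g-hom _ _ = hom

  g-ext : ∀ x (p : x ∈ (a ∷ A)) (q : Component Γ v x) → g (x , q) ≡ f (x , p)
  g-ext x p _ = h̃-ext x p tt

lemma4p2 : (Γ : OrientedGraph) → HomHomogeneous Γ → Disconnected Γ →
           (v : OrientedGraph.V Γ) → HomHomogeneousOn Γ (Component Γ v)
lemma4p2 Γ hh _ = homHomogeneous⇒component-homHomogeneous Γ hh
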